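{- Let $N = q^k n^2$ be an odd perfect number, where $q$ is a prime with $q \equiv k \equiv 1 \pmod 4$ and $\gcd(q,n)=1$. Then $$I(n^2) = 2 - \frac{5}{3q}$$ holds if and only if $k=1$ and $q=5$.
   Context: For a positive integer $N$, $\sigma(N)$ denotes the sum of the positive divisors of $N$; $N$ is perfect if $\sigma(N)=2N$. The abundancy index of a positive integer $w$ is $I(w)=\sigma(w)/w$. Euler showed every odd perfect number can be written as $q^k n^2$ with $q$ prime, $q \equiv k \equiv 1 \pmod 4$, and $\gcd(q,n)=1$; such $q$ is called the Euler prime. -}

module Defs where

open import Data.Nat using (ℕ; zero; suc; _+_; _*_; _^_)
open import Data.Nat.Divisibility using (_∣?_)
open import Data.List using (filter; upTo; map)
open import Data.Nat.ListAction using (sum)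
open import Data.Integer using (ℤ; +_)
open import Data.Rational using (ℚ; _/_; 0ℚ)
open import Relation.Binary.PropositionalEquality using (_≡_)

σ : ℕ → ℕ
σ N = sum (filter (λ d → d ∣? N) (map suc (upTo N)))

-- N is perfect iff σ(N) = 2N (positivity of N is a separate hypothesis
-- in the theorem; odd N is automatically positive).
Perfect : ℕ → Set
Perfect N = (σ N ≡ 2 * N)

-- Abundancy index I(w) = σ(w)/w for a positive integer w.
-- (Value at w = 0 is a junk value 0; never used for positive w.)
I : ℕ → ℚ
I zero = 0ℚ
I (suc w) = (+ σ (suc w)) / suc w

-- Rational a/d with natural denominator; junk value 0 when d = 0
-- (only used with positive denominators).
infixl 7 _÷ₙ_
_÷ₙ_ : ℤ → ℕ → ℚ
a ÷ₙ zero = 0ℚ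
a ÷ₙ suc d = a / suc d

module Submission where

-- Put m = n² and G = 1 + q + … + q^k.  Because the prime q does not divide m,
-- σ(q^k·m) = σ(m)·G, so perfection reads σ(m)·G = 2q^k·m.  Clearing
-- denominators, I(m) = 2 - 5/(3q) is the equation 3q·σ(m) + 5m = 6q·m.
-- Multiplying it by G and cancelling m leaves 6q^(k+1) + 5G = 6q·G; since
-- q ∤ G this gives q ∣ 5, so q = 5, and then 6·5^k = 5G forces k = 1.
-- Conversely, for q = 5 and k = 1 perfection gives 6σ(m) = 10m, which is
-- the abundancy equation.

open import Defs
open import Data.Nat.Base using (ℕ; nonTrivial⇒≢1; zero; suc; _+_; _*_; _^_; _∸_; _%_; _<_; _≤_; >-nonZero; >-nonZero⁻¹; s≤s; z<s)
open import Data.Nat.Properties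
open import Data.Nat.Divisibility
open import Data.Nat.Primality using (Prime; prime?; prime⇒nonZero; ¬prime[0]; prime⇒irreducible; prime⇒nonTrivial; euclidsLemma)
open import Data.Nat.Coprimality using (Coprime; coprime-divisor; gcd≡1⇒coprime)
open import Data.Nat.GCD using (gcd)
open import Data.Nat.ListAction using (sum)
open import Data.Nat.ListAction.Properties using (sum-++)
open import Data.Nat.Tactic.RingSolver using (solve-∀)
open import Data.List.Base using (List; []; _∷_; filter; map; upTo; applyUpTo; _++_; [_])
open import Data.List.Properties using (map-upTo; applyUpTo-∷ʳ; map-++)
open import Data.Bool.Base using (true; false; if_then_else_)
open import Data.Sum.Base using (_⊎_; inj₁; inj₂; [_,_]′)
open import Function.Base using (id)
open import Function.Bundles using (_⇔_; mk⇔)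
open import Function.Properties.Equivalence using () renaming (trans to ⇔-trans)
open import Data.Product.Base using (_×_; _,_)
open import Data.Integer.Base using (+_)
import Data.Integer.Base as ℤ
import Data.Integer.Properties as ℤ
import Data.Integer.Tactic.RingSolver as ℤ-Solver
open import Data.Rational.Base using (_/_; _-_; -_; fromℚᵘ)
open import Data.Rational.Properties
  using (fromℚᵘ-injective; fromℚᵘ-cong; fromℚᵘ-toℚᵘ; toℚᵘ-fromℚᵘ; toℚᵘ-homo-+; toℚᵘ-homo‿-)
open import Data.Rational.Unnormalised.Base using (ℚᵘ; mkℚᵘ; *≡*) renaming (_≃_ to _≃ᵘ_)
import Data.Rational.Unnormalised.Base as ℚᵘ
import Data.Rational.Unnormalised.Properties as ℚᵘ
open import Relation.Nullary.Decidable using (from-yes)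
open import Relation.Nullary using (Dec; yes; no; does; ¬_; ¬?; contradiction)
open import Algebra.Properties.CommutativeSemigroup +-commutativeSemigroup
  renaming (interchange to +-interchange) using ()
open import Relation.Unary using (Pred; Decidable)
open import Relation.Binary.PropositionalEquality using (_≡_; _≢_; refl; sym; trans; cong; cong₂; subst; module ≡-Reasoning)

select : {P : Set} → Dec P → ℕ → ℕ
select P? x = if does P? then x else 0

select-yes : {P : Set} (P? : Dec P) {x : ℕ} → P → select P? x ≡ x
select-yes (yes _) _ = refl
select-yes (no ¬p) p = contradiction p ¬p

select-no : {P : Set} (P? : Dec P) {x : ℕ} → ¬ P → select P? x ≡ 0
select-no (yes p) ¬p = contradiction p ¬p
select-no (no _)  _  = refl

select-⇔ : {P Q : Set} (P? : Dec P) (Q? : Dec Q) {x : ℕ} →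
           (P → Q) → (Q → P) → select P? x ≡ select Q? x
select-⇔ (yes _) (yes _) _ _ = refl
select-⇔ (yes p) (no ¬q) f _ = contradiction (f p) ¬q
select-⇔ (no ¬p) (yes q) _ g = contradiction (g q) ¬p
select-⇔ (no _)  (no _)  _ _ = refl

select-split : {P : Set} (P? : Dec P) (x : ℕ) → x ≡ select (¬? P?) x + select P? x
select-split (yes _) x = refl
select-split (no _)  x = sym (+-identityʳ x)

select-¬-cases : {P : Set} (P? : Dec P) {x y : ℕ} → (P → y ≡ 0) → (¬ P → x ≡ y) → select (¬? P?) x ≡ y
select-¬-cases (yes p) y≡0 _ = sym (y≡0 p)
select-¬-cases (no ¬p) _ x≡y = x≡y ¬p

select-* : {P : Set} (P? : Dec P) (c x : ℕ) → select P? (x * c) ≡ c * select P? x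
select-* (yes _) c x = *-comm x c
select-* (no _)  c x = sym (*-zeroʳ c)

sum-filter : {P : Pred ℕ _} (P? : Decidable P) (xs : List ℕ) →
             sum (filter P? xs) ≡ sum (map (λ x → select (P? x) x) xs)
sum-filter P? []       = refl
sum-filter P? (x ∷ xs) with does (P? x)
... | true  = cong (λ s → x + s) (sum-filter P? xs)
... | false = sum-filter P? xs

sumTo : ℕ → (ℕ → ℕ) → ℕ
sumTo zero    f = 0
sumTo (suc n) f = sumTo n f + f (suc n)

sum-map-applyUpTo-suc : (f : ℕ → ℕ) (n : ℕ) → sum (map f (applyUpTo suc n)) ≡ sumTo n f
sum-map-applyUpTo-suc f zero    = refl
sum-map-applyUpTo-suc f (suc n) = begin
  sum (map f (applyUpTo suc (suc n)))            ≡⟨ cong (λ xs → sum (map f xs)) (sym (applyUpTo-∷ʳ suc n)) ⟩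
  sum (map f (applyUpTo suc n ++ [ suc n ]))     ≡⟨ cong sum (map-++ f (applyUpTo suc n) [ suc n ]) ⟩
  sum (map f (applyUpTo suc n) ++ [ f (suc n) ]) ≡⟨ sum-++ (map f (applyUpTo suc n)) [ f (suc n) ] ⟩
  sum (map f (applyUpTo suc n)) + (f (suc n) + 0) ≡⟨ cong₂ _+_ (sum-map-applyUpTo-suc f n) (+-identityʳ (f (suc n))) ⟩
  sumTo n f + f (suc n)                          ∎
  where open ≡-Reasoning

sumTo-cong : ∀ n {f g : ℕ → ℕ} → (∀ d → 0 < d → d ≤ n → f d ≡ g d) → sumTo n f ≡ sumTo n g
sumTo-cong zero    eq = refl
sumTo-cong (suc n) eq =
  cong₂ _+_ (sumTo-cong n (λ d 0<d d≤n → eq d 0<d (m≤n⇒m≤1+n d≤n))) (eq (suc n) z<s ≤-refl)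

sumTo-zero : ∀ n → sumTo n (λ _ → 0) ≡ 0
sumTo-zero zero    = refl
sumTo-zero (suc n) = cong (_+ 0) (sumTo-zero n)

sumTo-+ : ∀ n (f g : ℕ → ℕ) → sumTo n (λ d → f d + g d) ≡ sumTo n f + sumTo n g
sumTo-+ zero    f g = refl
sumTo-+ (suc n) f g = trans (cong (_+ (f (suc n) + g (suc n))) (sumTo-+ n f g))
                            (+-interchange (sumTo n f) (sumTo n g) (f (suc n)) (g (suc n)))

sumTo-* : ∀ n c (f : ℕ → ℕ) → sumTo n (λ d → c * f d) ≡ c * sumTo n f
sumTo-* zero    c f = sym (*-zeroʳ c)
sumTo-* (suc n) c f = trans (cong (_+ c * f (suc n)) (sumTo-* n c f))
                            (sym (*-distribˡ-+ c (sumTo n f) (f (suc n))))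

sumTo-split : ∀ a b (f : ℕ → ℕ) → sumTo (a + b) f ≡ sumTo a f + sumTo b (λ d → f (a + d))
sumTo-split a zero    f = trans (cong (λ n → sumTo n f) (+-identityʳ a)) (sym (+-identityʳ _))
sumTo-split a (suc b) f = begin
  sumTo (a + suc b) f                                   ≡⟨ cong (λ n → sumTo n f) (+-suc a b) ⟩
  sumTo (a + b) f + f (suc (a + b))                     ≡⟨ cong₂ (λ s x → s + f x) (sumTo-split a b f) (sym (+-suc a b)) ⟩
  (sumTo a f + sumTo b (λ d → f (a + d))) + f (a + suc b) ≡⟨ +-assoc (sumTo a f) _ _ ⟩
  sumTo a f + sumTo (suc b) (λ d → f (a + d))           ∎
  where open ≡-Reasoning

∤-between-multiples : ∀ {q} M j → 0 < j → j < q → ¬ q ∣ M * q + j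
∤-between-multiples M j 0<j j<q q∣Mq+j =
  <⇒≱ j<q (∣⇒≤ ⦃ >-nonZero 0<j ⦄ (∣m+n∣m⇒∣n q∣Mq+j (n∣m*n M)))

-- The only multiple of q in the block M·q+1 ‥ M·q+q is (M+1)·q.
block-sum : ∀ p M (g : ℕ → ℕ) →
  sumTo (suc p) (λ j → select (suc p ∣? M * suc p + j) (g (M * suc p + j))) ≡ g (suc M * suc p)
block-sum p M g = cong₂ _+_ inner-terms-vanish (last-term (M * q + q) (+-comm (M * q) q))
  where
  q : ℕ
  q = suc p
  inner-terms-vanish : sumTo p (λ j → select (q ∣? M * q + j) (g (M * q + j))) ≡ 0
  inner-terms-vanish = trans
    (sumTo-cong p (λ j 0<j j≤p → select-no (q ∣? M * q + j) (∤-between-multiples M j 0<j (s≤s j≤p))))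
    (sumTo-zero p)
  last-term : ∀ x → x ≡ suc M * q → select (q ∣? x) (g x) ≡ g (suc M * q)
  last-term x refl = select-yes (q ∣? x) (n∣m*n (suc M))

sumTo-multiples : ∀ p M (g : ℕ → ℕ) →
  sumTo (M * suc p) (λ d → select (suc p ∣? d) (g d)) ≡ sumTo M (λ e → g (e * suc p))
sumTo-multiples p zero    g = refl
sumTo-multiples p (suc M) g = begin
  sumTo (suc M * q) F                            ≡⟨ cong (λ n → sumTo n F) (+-comm q (M * q)) ⟩
  sumTo (M * q + q) F                            ≡⟨ sumTo-split (M * q) q F ⟩
  sumTo (M * q) F + sumTo q (λ j → F (M * q + j)) ≡⟨ cong₂ _+_ (sumTo-multiples p M g) (block-sum p M g) ⟩
  sumTo M (λ e → g (e * q)) + g (suc M * q)      ∎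
  where
  open ≡-Reasoning
  q : ℕ
  q = suc p
  F : ℕ → ℕ
  F d = select (q ∣? d) (g d)

divisorPart : ℕ → ℕ → ℕ
divisorPart N d = select (d ∣? N) d

σ-as-sumTo : ∀ N → σ N ≡ sumTo N (divisorPart N)
σ-as-sumTo N = begin
  sum (filter (_∣? N) (map suc (upTo N)))       ≡⟨ sum-filter (_∣? N) (map suc (upTo N)) ⟩
  sum (map (divisorPart N) (map suc (upTo N)))  ≡⟨ cong (λ xs → sum (map (divisorPart N) xs)) (map-upTo suc N) ⟩
  sum (map (divisorPart N) (applyUpTo suc N))   ≡⟨ sum-map-applyUpTo-suc (divisorPart N) N ⟩
  sumTo N (divisorPart N)                       ∎
  where open ≡-Reasoning

-- The divisors of m > 0 are at most m, so any longer range gives σ m as well.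
σ-as-longer-sum : ∀ m B → 0 < m → m ≤ B → sumTo B (divisorPart m) ≡ σ m
σ-as-longer-sum m B 0<m m≤B = begin
  sumTo B (divisorPart m)                                       ≡⟨ cong (λ n → sumTo n (divisorPart m)) (sym (m+[n∸m]≡n m≤B)) ⟩
  sumTo (m + (B ∸ m)) (divisorPart m)                           ≡⟨ sumTo-split m (B ∸ m) (divisorPart m) ⟩
  sumTo m (divisorPart m) + sumTo (B ∸ m) (λ d → divisorPart m (m + d)) ≡⟨ cong (λ s → sumTo m (divisorPart m) + s) tail-vanishes ⟩
  sumTo m (divisorPart m) + 0                                   ≡⟨ +-identityʳ _ ⟩
  sumTo m (divisorPart m)                                       ≡⟨ sym (σ-as-sumTo m) ⟩
  σ m                                                           ∎
  where
  open ≡-Reasoning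
  tail-vanishes : sumTo (B ∸ m) (λ d → divisorPart m (m + d)) ≡ 0
  tail-vanishes = trans
    (sumTo-cong (B ∸ m) (λ d 0<d _ → select-no (m + d ∣? m)
      (λ m+d∣m → <⇒≱ (m<m+n m 0<d) (∣⇒≤ ⦃ >-nonZero 0<m ⦄ m+d∣m))))
    (sumTo-zero (B ∸ m))

-- The divisors of M·q not divisible by q are
-- then exactly the divisors of m, and the others are the e·q with e ∣ M, so
-- σ(M·q) = σ(m) + q·σ(M).
σ-extend : ∀ p m M → 0 < m → 0 < M → ¬ suc p ∣ m → m ∣ M →
  (∀ d → ¬ suc p ∣ d → d ∣ M * suc p → d ∣ m) → σ (M * suc p) ≡ σ m + suc p * σ M
σ-extend p m M 0<m 0<M q∤m m∣M nonMultiple⇒∣m = begin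
  σ N                                                 ≡⟨ σ-as-sumTo N ⟩
  sumTo N (divisorPart N)                             ≡⟨ sumTo-cong N (λ d _ _ → select-split (q ∣? d) (divisorPart N d)) ⟩
  sumTo N (λ d → nonMultiplePart d + multiplePart d)  ≡⟨ sumTo-+ N nonMultiplePart multiplePart ⟩
  sumTo N nonMultiplePart + sumTo N multiplePart      ≡⟨ cong₂ _+_ nonMultiple-sum multiple-sum ⟩
  σ m + q * σ M                                       ∎
  where
  open ≡-Reasoning
  q : ℕ
  q = suc p
  N : ℕ
  N = M * q

  nonMultiplePart multiplePart : ℕ → ℕ
  nonMultiplePart d = select (¬? (q ∣? d)) (divisorPart N d)
  multiplePart    d = select (q ∣? d) (divisorPart N d)

  m∣N : m ∣ N
  m∣N = ∣-trans m∣M (m∣m*n q)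

  nonMultiplePart≡ : ∀ d → nonMultiplePart d ≡ divisorPart m d
  nonMultiplePart≡ d = select-¬-cases (q ∣? d)
    (λ q∣d → select-no (d ∣? m) (λ d∣m → q∤m (∣-trans q∣d d∣m)))
    (λ q∤d → select-⇔ (d ∣? N) (d ∣? m) (nonMultiple⇒∣m d q∤d) (λ d∣m → ∣-trans d∣m m∣N))

  nonMultiple-sum : sumTo N nonMultiplePart ≡ σ m
  nonMultiple-sum = trans (sumTo-cong N (λ d _ _ → nonMultiplePart≡ d))
    (σ-as-longer-sum m N 0<m (∣⇒≤ ⦃ >-nonZero (*-mono-< 0<M z<s) ⦄ m∣N))

  multipleOf-divisorPart : ∀ e → divisorPart N (e * q) ≡ q * divisorPart M e
  multipleOf-divisorPart e =
    trans (select-⇔ (e * q ∣? N) (e ∣? M) (*-cancelʳ-∣ q) (*-monoˡ-∣ q)) (select-* (e ∣? M) q e)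

  multiple-sum : sumTo N multiplePart ≡ q * σ M
  multiple-sum = begin
    sumTo N multiplePart                   ≡⟨ sumTo-multiples p M (divisorPart N) ⟩
    sumTo M (λ e → divisorPart N (e * q))  ≡⟨ sumTo-cong M (λ e _ _ → multipleOf-divisorPart e) ⟩
    sumTo M (λ e → q * divisorPart M e)    ≡⟨ sumTo-* M q (divisorPart M) ⟩
    q * sumTo M (divisorPart M)            ≡⟨ cong (q *_) (sym (σ-as-sumTo M)) ⟩
    q * σ M                                ∎

geometric : ℕ → ℕ → ℕ
geometric q zero    = 1
geometric q (suc k) = 1 + q * geometric q k

prime∤⇒coprime : ∀ {q d} → Prime q → ¬ q ∣ d → Coprime d q
prime∤⇒coprime pr q∤d (i∣d , i∣q) with prime⇒irreducible pr i∣q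
... | inj₁ i≡1 = i≡1
... | inj₂ refl = contradiction i∣d q∤d

prime∤⇒∣cofactor : ∀ {q d m} k → Prime q → ¬ q ∣ d → d ∣ q ^ k * m → d ∣ m
prime∤⇒∣cofactor {m = m} zero pr q∤d d∣ = subst (_ ∣_) (*-identityˡ m) d∣
prime∤⇒∣cofactor {q} {d} {m} (suc k) pr q∤d d∣ = prime∤⇒∣cofactor k pr q∤d
  (coprime-divisor (prime∤⇒coprime pr q∤d) (subst (d ∣_) (*-assoc q (q ^ k) m) d∣))

σ-prime-power : ∀ q k m → Prime q → 0 < m → ¬ q ∣ m → σ (q ^ k * m) ≡ σ m * geometric q k
σ-prime-power zero    k       m pr _ _ = contradiction pr ¬prime[0]
σ-prime-power (suc p) zero    m pr _ _ = trans (cong σ (*-identityˡ m)) (sym (*-identityʳ (σ m)))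
σ-prime-power (suc p) (suc k) m pr 0<m q∤m = begin
  σ (q ^ suc k * m)               ≡⟨ cong σ peel-factor ⟩
  σ (M * q)                       ≡⟨ σ-extend p m M 0<m (*-mono-< (m^n>0 q k) 0<m) q∤m (n∣m*n (q ^ k))
                                       (λ d q∤d d∣ → prime∤⇒∣cofactor (suc k) pr q∤d (subst (d ∣_) (sym peel-factor) d∣)) ⟩
  σ m + q * σ M                   ≡⟨ cong (λ s → σ m + q * s) (σ-prime-power q k m pr 0<m q∤m) ⟩
  σ m + q * (σ m * geometric q k) ≡⟨ factor-σ (σ m) q (geometric q k) ⟩
  σ m * geometric q (suc k)       ∎
  where
  open ≡-Reasoning
  q : ℕ
  q = suc p
  M : ℕ
  M = q ^ k * m
  peel-factor : q ^ suc k * m ≡ M * q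
  peel-factor = trans (*-assoc q (q ^ k) m) (*-comm q M)
  factor-σ : ∀ s q g → s + q * (s * g) ≡ s * (1 + q * g)
  factor-σ = solve-∀

∣geometric⇒≡1 : ∀ q k → q ∣ geometric q k → q ≡ 1
∣geometric⇒≡1 q zero    q∣1 = ∣1⇒≡1 q∣1
∣geometric⇒≡1 q (suc k) q∣g = ∣1⇒≡1
  (∣m+n∣m⇒∣n (subst (q ∣_) (+-comm 1 (q * geometric q k)) q∣g) (m∣m*n (geometric q k)))

prime≢1 : ∀ {q} → Prime q → q ≢ 1
prime≢1 pr = nonTrivial⇒≢1 ⦃ prime⇒nonTrivial pr ⦄

prime[5] : Prime 5
prime[5] = from-yes (prime? 5)

-- Write s = σ(m) and G = σ(q^k).  Multiplying the abundancy equation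
-- 3q·s + 5m = 6q·m by G, substituting s·G = 2q^k·m and cancelling m
-- leaves an equation in q and k alone.
abundancy⇒prime-power-equation : ∀ q k m s → 0 < m → s * geometric q k ≡ 2 * (q ^ k * m) →
  s * (3 * q) + 5 * m ≡ 2 * (3 * q) * m → 6 * (q * q ^ k) + 5 * geometric q k ≡ 6 * q * geometric q k
abundancy⇒prime-power-equation q k m s 0<m factorisation abundancy =
  *-cancelˡ-≡ _ _ m ⦃ >-nonZero 0<m ⦄ (begin
    m * (6 * (q * Q) + 5 * G)          ≡⟨ expand q Q m G ⟩
    3 * q * (2 * (Q * m)) + 5 * m * G  ≡⟨ cong (λ x → 3 * q * x + 5 * m * G) (sym factorisation) ⟩
    3 * q * (s * G) + 5 * m * G        ≡⟨ collect q m s G ⟩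
    (s * (3 * q) + 5 * m) * G          ≡⟨ cong (_* G) abundancy ⟩
    2 * (3 * q) * m * G                ≡⟨ regroup q m G ⟩
    m * (6 * q * G)                    ∎)
  where
  open ≡-Reasoning
  Q : ℕ
  Q = q ^ k
  G : ℕ
  G = geometric q k
  expand : ∀ q Q m G → m * (6 * (q * Q) + 5 * G) ≡ 3 * q * (2 * (Q * m)) + 5 * m * G
  expand = solve-∀
  collect : ∀ q m s G → 3 * q * (s * G) + 5 * m * G ≡ (s * (3 * q) + 5 * m) * G
  collect = solve-∀
  regroup : ∀ q m G → 2 * (3 * q) * m * G ≡ m * (6 * q * G)
  regroup = solve-∀

-- In that equation q divides 5·σ(q^k) but not σ(q^k), so the prime q is 5.
prime-power-equation⇒q≡5 : ∀ q k → Prime q →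
  6 * (q * q ^ k) + 5 * geometric q k ≡ 6 * q * geometric q k → q ≡ 5
prime-power-equation⇒q≡5 q k pr eq = from-prime-factor (euclidsLemma 5 G pr q∣5G)
  where
  G : ℕ
  G = geometric q k
  q∣5G : q ∣ 5 * G
  q∣5G = ∣m+n∣m⇒∣n (subst (q ∣_) (sym eq) (n∣m*n*o 6 G)) (∣-trans (m∣m*n (q ^ k)) (n∣m*n 6))
  from-prime-factor : q ∣ 5 ⊎ q ∣ G → q ≡ 5
  from-prime-factor (inj₁ q∣5) = [ (λ q≡1 → contradiction q≡1 (prime≢1 pr)) , id ]′ (prime⇒irreducible prime[5] q∣5)
  from-prime-factor (inj₂ q∣G) = contradiction (∣geometric⇒≡1 q k q∣G) (prime≢1 pr)

-- For q = 5 the equation reads 6·5^k = 5·σ(5^k), which forces k = 1: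
-- k = 0 gives 6 = 5, and k ≥ 2 would make 5 divide σ(5^k).
prime-power-equation⇒k≡1 : ∀ k → 6 * (5 * 5 ^ k) + 5 * geometric 5 k ≡ 6 * 5 * geometric 5 k → k ≡ 1
prime-power-equation⇒k≡1 k eq = six-powers k
  (*-cancelˡ-≡ _ _ 5 (trans (pull-five (5 ^ k))
    (trans (+-cancelʳ-≡ (5 * G) _ _ (trans eq (split-thirty G))) (pull-five′ G))))
  where
  G : ℕ
  G = geometric 5 k
  pull-five : ∀ X → 5 * (6 * X) ≡ 6 * (5 * X)
  pull-five = solve-∀
  split-thirty : ∀ G → 6 * 5 * G ≡ 25 * G + 5 * G
  split-thirty = solve-∀
  pull-five′ : ∀ G → 25 * G ≡ 5 * (5 * G)
  pull-five′ = solve-∀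
  six-powers : ∀ k → 6 * 5 ^ k ≡ 5 * geometric 5 k → k ≡ 1
  six-powers zero          ()
  six-powers (suc zero)    _  = refl
  six-powers (suc (suc j)) eq = contradiction (∣geometric⇒≡1 5 (suc (suc j)) 5∣G) (λ ())
    where
    five-factors : ∀ X → 5 * (6 * X * 5) ≡ 6 * (5 * (5 * X))
    five-factors = solve-∀
    5∣G : 5 ∣ geometric 5 (suc (suc j))
    5∣G = divides (6 * 5 ^ j) (*-cancelˡ-≡ _ _ 5 (trans (sym eq) (sym (five-factors (5 ^ j)))))

abundancy-equation-at-5 : ∀ m s → s * geometric 5 1 ≡ 2 * (5 ^ 1 * m) → s * (3 * 5) + 5 * m ≡ 2 * (3 * 5) * m
abundancy-equation-at-5 m s factorisation = *-cancelˡ-≡ _ _ 2 (begin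
  2 * (s * 15 + 5 * m)    ≡⟨ double-lhs s m ⟩
  5 * (s * 6) + 10 * m    ≡⟨ cong (λ x → 5 * x + 10 * m) factorisation ⟩
  5 * (2 * (5 * m)) + 10 * m ≡⟨ double-rhs m ⟩
  2 * (30 * m)            ∎)
  where
  open ≡-Reasoning
  double-lhs : ∀ s m → 2 * (s * 15 + 5 * m) ≡ 5 * (s * 6) + 10 * m
  double-lhs = solve-∀
  double-rhs : ∀ m → 5 * (2 * (5 * m)) + 10 * m ≡ 2 * (30 * m)
  double-rhs = solve-∀

abundancy-equation⇔ : ∀ q k m s → Prime q → 0 < m → s * geometric q k ≡ 2 * (q ^ k * m) →
  (s * (3 * q) + 5 * m ≡ 2 * (3 * q) * m) ⇔ (k ≡ 1 × q ≡ 5)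
abundancy-equation⇔ q k m s pr 0<m factorisation = mk⇔ forward backward
  where
  forward : s * (3 * q) + 5 * m ≡ 2 * (3 * q) * m → k ≡ 1 × q ≡ 5
  forward abundancy = at-q≡5 (prime-power-equation⇒q≡5 q k pr equation) equation
    where
    equation : 6 * (q * q ^ k) + 5 * geometric q k ≡ 6 * q * geometric q k
    equation = abundancy⇒prime-power-equation q k m s 0<m factorisation abundancy
    at-q≡5 : ∀ {q} → q ≡ 5 → 6 * (q * q ^ k) + 5 * geometric q k ≡ 6 * q * geometric q k → k ≡ 1 × q ≡ 5
    at-q≡5 refl eq = prime-power-equation⇒k≡1 k eq , refl
  backward : k ≡ 1 × q ≡ 5 → s * (3 * q) + 5 * m ≡ 2 * (3 * q) * m
  backward (refl , refl) = abundancy-equation-at-5 m s factorisation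

fromℚᵘ-homo-− : ∀ p r → fromℚᵘ p - fromℚᵘ r ≡ fromℚᵘ (p ℚᵘ.- r)
fromℚᵘ-homo-− p r = trans (sym (fromℚᵘ-toℚᵘ (fromℚᵘ p - fromℚᵘ r))) (fromℚᵘ-cong
  (ℚᵘ.≃-trans (toℚᵘ-homo-+ (fromℚᵘ p) (- fromℚᵘ r))
    (ℚᵘ.+-cong (toℚᵘ-fromℚᵘ p) (ℚᵘ.≃-trans (toℚᵘ-homo‿- (fromℚᵘ r)) (ℚᵘ.-‿cong (toℚᵘ-fromℚᵘ r))))))

difference-as-fraction : ∀ x y c → mkℚᵘ (+ x) 0 ℚᵘ.- mkℚᵘ (+ y) c ≃ᵘ mkℚᵘ (+ x ℤ.* + suc c ℤ.- + y) c
difference-as-fraction x y c = *≡* (trans (same-denominator (+ x) (+ y) (+ suc c))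
  (cong (λ n → (+ x ℤ.* + suc c ℤ.- + y) ℤ.* + n) (sym (*-identityˡ (suc c)))))
  where
  same-denominator : ∀ X Y C → (X ℤ.* C ℤ.+ ℤ.- Y ℤ.* + 1) ℤ.* C ≡ (X ℤ.* C ℤ.- Y) ℤ.* C
  same-denominator = ℤ-Solver.solve-∀

≡difference*⇔ : ∀ u P Y B → (u ≡ (P ℤ.- Y) ℤ.* B) ⇔ (u ℤ.+ Y ℤ.* B ≡ P ℤ.* B)
≡difference*⇔ u P Y B = mk⇔
  (λ e → trans (cong (ℤ._+ Y ℤ.* B) e) (cancel-difference P Y B))
  (λ e → trans (add-subtract u Y B) (trans (cong (ℤ._- Y ℤ.* B) e) (factor-difference P Y B)))
  where
  cancel-difference : ∀ P Y B → (P ℤ.- Y) ℤ.* B ℤ.+ Y ℤ.* B ≡ P ℤ.* B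
  cancel-difference = ℤ-Solver.solve-∀
  add-subtract : ∀ u Y B → u ≡ (u ℤ.+ Y ℤ.* B) ℤ.- Y ℤ.* B
  add-subtract = ℤ-Solver.solve-∀
  factor-difference : ∀ P Y B → P ℤ.* B ℤ.- Y ℤ.* B ≡ (P ℤ.- Y) ℤ.* B
  factor-difference = ℤ-Solver.solve-∀

cast-equation⇔ : ∀ a C y B x → (+ a ℤ.* + C ℤ.+ + y ℤ.* + B ≡ + x ℤ.* + C ℤ.* + B) ⇔ (a * C + y * B ≡ x * C * B)
cast-equation⇔ a C y B x = mk⇔
  (λ e → ℤ.+-injective (trans cast-lhs (trans e (sym cast-rhs))))
  (λ e → trans (sym cast-lhs) (trans (cong +_ e) cast-rhs))
  where
  cast-lhs : + (a * C + y * B) ≡ + a ℤ.* + C ℤ.+ + y ℤ.* + B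
  cast-lhs = trans (ℤ.pos-+ (a * C) (y * B)) (cong₂ ℤ._+_ (ℤ.pos-* a C) (ℤ.pos-* y B))
  cast-rhs : + (x * C * B) ≡ + x ℤ.* + C ℤ.* + B
  cast-rhs = trans (ℤ.pos-* (x * C) B) (cong (ℤ._* + B) (ℤ.pos-* x C))

fraction≡difference⇔ : ∀ a b x y c →
  (+ a / suc b ≡ (+ x / 1) - (+ y / suc c)) ⇔ (a * suc c + y * suc b ≡ x * suc c * suc b)
fraction≡difference⇔ a b x y c =
  ⇔-trans (mk⇔ to-integers from-integers)
    (⇔-trans (≡difference*⇔ (+ a ℤ.* + suc c) (+ x ℤ.* + suc c) (+ y) (+ suc b))
      (cast-equation⇔ a (suc c) y (suc b) x))
  where
  D : ℚᵘ
  D = mkℚᵘ (+ x) 0 ℚᵘ.- mkℚᵘ (+ y) c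
  difference : (+ x / 1) - (+ y / suc c) ≡ fromℚᵘ D
  difference = fromℚᵘ-homo-− (mkℚᵘ (+ x) 0) (mkℚᵘ (+ y) c)
  to-integers : + a / suc b ≡ (+ x / 1) - (+ y / suc c) →
                + a ℤ.* + suc c ≡ (+ x ℤ.* + suc c ℤ.- + y) ℤ.* + suc b
  to-integers e with ℚᵘ.≃-trans (fromℚᵘ-injective {mkℚᵘ (+ a) b} {D} (trans e difference)) (difference-as-fraction x y c)
  ... | *≡* cross = cross
  from-integers : + a ℤ.* + suc c ≡ (+ x ℤ.* + suc c ℤ.- + y) ℤ.* + suc b →
                  + a / suc b ≡ (+ x / 1) - (+ y / suc c)
  from-integers cross = trans
    (fromℚᵘ-cong {mkℚᵘ (+ a) b} {D} (ℚᵘ.≃-trans (*≡* cross) (ℚᵘ.≃-sym (difference-as-fraction x y c)))) (sym difference)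

I≡2-5/c⇔ : ∀ w c → 0 < w → 0 < c → (I w ≡ (+ 2 / 1) - (+ 5 ÷ₙ c)) ⇔ (σ w * c + 5 * w ≡ 2 * c * w)
I≡2-5/c⇔ (suc w) (suc c) _ _ = fraction≡difference⇔ (σ (suc w)) w 2 5 c

coprime⇒∤square : ∀ {q n} → q ≢ 1 → Coprime q n → ¬ q ∣ n ^ 2
coprime⇒∤square {q} {n} q≢1 q⊥n q∣n² =
  q≢1 (q⊥n (∣-refl , subst (q ∣_) (*-identityʳ n) (coprime-divisor q⊥n q∣n²)))

theorem1 : (q k n : ℕ) → Prime q → q % 4 ≡ 1 → k % 4 ≡ 1 → gcd q n ≡ 1 →
    0 < q ^ k * n ^ 2 → q ^ k * n ^ 2 % 2 ≡ 1 → Perfect (q ^ k * n ^ 2) →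
    (I (n ^ 2) ≡ (+ 2 / 1) - (+ 5 ÷ₙ (3 * q))) ⇔ (k ≡ 1 × q ≡ 5)
theorem1 q k n pr _ _ gcd≡1 0<N _ perfect =
  ⇔-trans (I≡2-5/c⇔ m (3 * q) 0<m 0<3q) (abundancy-equation⇔ q k m (σ m) pr 0<m factorisation)
  where
  m : ℕ
  m = n ^ 2
  0<m : 0 < m
  0<m = >-nonZero⁻¹ m ⦃ m*n≢0⇒n≢0 (q ^ k) ⦃ >-nonZero 0<N ⦄ ⦄
  0<3q : 0 < 3 * q
  0<3q = *-mono-< {0} {3} z<s (>-nonZero⁻¹ q ⦃ prime⇒nonZero pr ⦄)
  factorisation : σ m * geometric q k ≡ 2 * (q ^ k * m)
  factorisation = trans (sym (σ-prime-power q k m pr 0<m (coprime⇒∤square (prime≢1 pr) (gcd≡1⇒coprime gcd≡1)))) perfect
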